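{- Let $G$ be a connected graph of order $n\ge 4$ with $m$ edges such that its complement $\overline{G}$ is connected. Then $$2|\mathrm{leaf}(\overline{G})|\le \gamma_{tc}(M(\overline{G}))\le n+\frac{n(n-1)}{2}-m-1.$$
   Context: All graphs are finite, simple and undirected; $\overline{G}$ is the complement of $G$, and $\mathrm{leaf}(H)=\{v\in V(H)\mid \deg_H(v)=1\}$. For a graph $H$, a set $D\subseteq V(H)$ is a total dominating set if every vertex of $H$ has a neighbor in $D$. A set $D\subseteq V(H)$ is a total outer-connected dominating set of $H$ if $D$ is a total dominating set and the induced subgraph $H[V(H)\setminus D]$ is connected; $\gamma_{tc}(H)$ denotes the minimum cardinality of a total outer-connected dominating set of $H$. The middle graph $M(G)$ of a graph $G$ has vertex set $V(G)\cup E(G)$, where two elements $x,y$ are adjacent iff either $x,y\in E(G)$ are edges of $G$ sharing an endpoint, or one of them is a vertex of $G$ and the other is an edge of $G$ incident to it. -}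

module Defs where

open import Data.Nat using (ℕ; zero; suc; _+_; _*_; _∸_; _≤_; _<_)
open import Data.Fin using (Fin; toℕ)
open import Data.Fin.Properties using () renaming (_≟_ to _≟ᶠ_)
open import Data.Bool using (Bool; true; false; T)
open import Data.List using (List; []; _∷_; length; filter; allFin)
open import Data.List.Membership.Propositional using (_∈_; _∉_)
open import Data.List.Relation.Unary.Unique.Propositional using (Unique)
open import Data.Product using (Σ; _×_; _,_; ∃; proj₁; proj₂)
open import Data.Sum using (_⊎_; inj₁; inj₂)
open import Data.Empty using (⊥)
open import Relation.Nullary using (¬_; Dec; yes; no)
open import Relation.Unary using (Decidable)
open import Relation.Binary.PropositionalEquality using (_≡_; _≢_)
import Data.Nat as ℕ

record SimpleGraph (n : ℕ) : Set where
  field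
    adj     : Fin n → Fin n → Bool
    sym     : ∀ i j → adj i j ≡ adj j i
    irrefl  : ∀ i → adj i i ≡ false
open SimpleGraph public

Adj : ∀ {n} → SimpleGraph n → Fin n → Fin n → Set
Adj G i j = T (adj G i j)

complement : ∀ {n} → SimpleGraph n → SimpleGraph n
complement {n} G = record { adj = cadj ; sym = csym ; irrefl = cirr }
  where
  cadj : Fin n → Fin n → Bool
  cadj i j with i ≟ᶠ j
  ... | yes _ = false
  ... | no  _ = Data.Bool.not (adj G i j)
  csym : ∀ i j → cadj i j ≡ cadj j i
  csym i j with i ≟ᶠ j | j ≟ᶠ i
  ... | yes _ | yes _ = Relation.Binary.PropositionalEquality.refl
  ... | yes p | no ¬q = Data.Empty.⊥-elim (¬q (Relation.Binary.PropositionalEquality.sym p))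
  ... | no ¬p | yes q = Data.Empty.⊥-elim (¬p (Relation.Binary.PropositionalEquality.sym q))
  ... | no _  | no _  = Relation.Binary.PropositionalEquality.cong Data.Bool.not (sym G i j)
  cirr : ∀ i → cadj i i ≡ false
  cirr i with i ≟ᶠ i
  ... | yes _ = Relation.Binary.PropositionalEquality.refl
  ... | no ¬p = Data.Empty.⊥-elim (¬p Relation.Binary.PropositionalEquality.refl)

data WalkIn {V : Set} (R : V → V → Set) (P : V → Set) : V → V → Set where
  here  : ∀ {x} → P x → WalkIn R P x x
  step  : ∀ {x y z} → P x → R x y → WalkIn R P y z → WalkIn R P x z

-- the subgraph induced by the vertices satisfying P is connected
-- (the null graph counts as connected)
ConnectedIn : {V : Set} → (V → V → Set) → (V → Set) → Set
ConnectedIn R P = ∀ x y → P x → P y → WalkIn R P x y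

Connected : ∀ {n} → SimpleGraph n → Set
Connected {n} G = ConnectedIn (Adj G) (λ _ → Data.Unit.⊤)
  where import Data.Unit

Edge : ∀ {n} → SimpleGraph n → Set
Edge {n} G = Σ (Fin n × Fin n) λ p → (toℕ (proj₁ p) < toℕ (proj₂ p)) × Adj G (proj₁ p) (proj₂ p)

isEdge? : ∀ {n} (G : SimpleGraph n) → Decidable (λ (p : Fin n × Fin n) → (toℕ (proj₁ p) < toℕ (proj₂ p)) × Adj G (proj₁ p) (proj₂ p))
isEdge? G (i , j) with toℕ i ℕ.<? toℕ j | Data.Bool.T? (adj G i j)
... | yes p | yes q = yes (p , q)
... | no ¬p | _     = no (λ r → ¬p (proj₁ r))
... | yes _ | no ¬q = no (λ r → ¬q (proj₂ r))

allPairs : ∀ n → List (Fin n × Fin n)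
allPairs n = Data.List.cartesianProduct (allFin n) (allFin n)

size : ∀ {n} → SimpleGraph n → ℕ
size {n} G = length (filter (isEdge? G) (allPairs n))

degree : ∀ {n} → SimpleGraph n → Fin n → ℕ
degree {n} G v = length (filter (λ w → Data.Bool.T? (adj G v w)) (allFin n))

leaves : ∀ {n} → SimpleGraph n → List (Fin n)
leaves {n} G = filter (λ v → degree G v ℕ.≟ 1) (allFin n)

-- Middle graph M(G): vertex set V(G) ⊎ E(G).

MVertex : ∀ {n} → SimpleGraph n → Set
MVertex {n} G = Fin n ⊎ Edge G

Incident : ∀ {n} (G : SimpleGraph n) → Fin n → Edge G → Set
Incident G v ((i , j) , _) = (v ≡ i) ⊎ (v ≡ j)

MAdj : ∀ {n} (G : SimpleGraph n) → MVertex G → MVertex G → Set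
MAdj G (inj₁ v) (inj₁ w) = ⊥
MAdj G (inj₁ v) (inj₂ e) = Incident G v e
MAdj G (inj₂ e) (inj₁ v) = Incident G v e
MAdj G (inj₂ e) (inj₂ f) = (e ≢ f) × ∃ λ v → Incident G v e × Incident G v f

-- Total outer-connected dominating sets of a graph given by an
-- adjacency relation R on V; a set is a duplicate-free list.

IsTotalDominating : {V : Set} → (V → V → Set) → List V → Set
IsTotalDominating {V} R D = ∀ (x : V) → ∃ λ y → (y ∈ D) × R x y

IsTOCDS : {V : Set} → (V → V → Set) → List V → Set
IsTOCDS R D = Unique D × IsTotalDominating R D × ConnectedIn R (λ x → x ∉ D)

-- Let H be the complement of G; it is connected with n ≥ 3 vertices, so no two leaves of H are
-- adjacent. In M(H) a leaf v is adjacent only to its unique edge, so a total dominating set D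
-- contains the edges of all leaves, and these are pairwise distinct. If D also contains every
-- leaf we have 2|leaf(H)| elements of D. Otherwise some leaf v₀ ∉ D is isolated in M(H) − D,
-- so connectivity of M(H) − D forces D to contain everything but v₀; swapping v₀ with its
-- neighbour (not a leaf) again maps the leaves injectively into the vertices of D.
-- For the upper bound, all edges of H together with all vertices but one form a total
-- outer-connected dominating set of size n − 1 + |E(H)| ≤ n − 1 + n(n − 1)/2 − m.
module Submission where

open import Defs
open import Data.Nat using (ℕ; _+_; _*_; _∸_; _≤_; _/_)
open import Data.List using (List; length)
open import Data.Product using (_×_; ∃)

open import Data.Bool using (T; T?; true; false)
open import Data.Bool.Properties using (T-irrelevant)
open import Data.Empty using (⊥; ⊥-elim)
open import Data.Fin using (Fin; toℕ) renaming (zero to fzero; suc to fsuc)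
open import Data.Fin.Permutation.Components using (transpose; transpose-inverse)
open import Data.Fin.Properties using (¬∀⟶∃¬; toℕ-injective; suc-injective; _≟_)
open import Data.List using ([]; _∷_; _++_; map; filter; allFin; tabulate; cartesianProduct)
import Data.List.Membership.DecPropositional as DecMembership
open import Data.List.Membership.Propositional using (_∈_; _∉_; _─_; mapWith∈; find; lose)
open import Data.List.Membership.Propositional.Properties
  using (∈-allFin; ∈-filter⁺; ∈-filter⁻; ∈-cartesianProduct⁺; ∈-++⁺ˡ; ∈-++⁺ʳ; ∈-++⁻; ∈-map⁺; ∈-map⁻)
import Data.List.Membership.Setoid.Properties as SetoidMembership
import Data.List.Properties as List
open import Data.List.Relation.Binary.Disjoint.Propositional using (Disjoint)
open import Data.List.Relation.Binary.Subset.Propositional using (_⊆_)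
open import Data.List.Relation.Unary.All as All using ([]; _∷_)
open import Data.List.Relation.Unary.AllPairs using ([]; _∷_)
open import Data.List.Relation.Unary.Any using (here; there; any?)
open import Data.List.Relation.Unary.Any.Properties using (mapWith∈⁺)
open import Data.List.Relation.Unary.Unique.Propositional using (Unique)
import Data.List.Relation.Unary.Unique.Propositional.Properties as Unique
import Data.Nat as ℕ
open import Data.Nat using (zero; suc; z≤n; s≤s; _<_; _<?_)
open import Data.Nat.DivMod using (m*n/n≡m)
open import Data.Nat.ListAction using (sum)
open import Data.Nat.Properties
  using (≤-trans; ≤-reflexive; <⇒≱; <-irrelevant; <-cmp; <-asym; +-suc; +-identityʳ; +-mono-≤;
         +-monoʳ-≤; *-comm; *-distribˡ-+; m+n≤o⇒m≤o∸n; module ≤-Reasoning)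
open import Data.Nat.Tactic.RingSolver using (solve-∀)
open import Data.Product using (Σ; _,_; proj₁; proj₂)
import Data.Product.Properties as Product
open import Data.Sum using (_⊎_; inj₁; inj₂; [_,_]′)
import Data.Sum.Properties as Sum
open import Data.Unit using (⊤; tt)
open import Function using (_∘_)
open import Relation.Binary.Definitions using (tri<; tri≈; tri>)
open import Relation.Binary.PropositionalEquality using (_≡_; _≢_; refl; trans; cong; cong₂; subst)
import Relation.Binary.PropositionalEquality as ≡
open import Relation.Nullary using (¬_; Dec; yes; no)
open import Relation.Nullary.Decidable using (map′; decidable-stable; ¬?)
open import Relation.Unary using (Decidable)
open import Relation.Unary.Properties using (∁?)

private
  variable
    A B : Set

∈-─ : ∀ {x z : A} {ys} (x∈ys : x ∈ ys) → z ∈ ys → z ≢ x → z ∈ ys ─ x∈ys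
∈-─ (here refl)  (here refl)  z≢x = ⊥-elim (z≢x refl)
∈-─ (here refl)  (there z∈ys) _   = z∈ys
∈-─ (there _)    (here refl)  _   = here refl
∈-─ (there x∈ys) (there z∈ys) z≢x = there (∈-─ x∈ys z∈ys z≢x)

injectiveOn⇒length≤ : (f : A → B) {xs : List A} {ys : List B} → Unique xs →
                      (∀ {x y} → x ∈ xs → y ∈ xs → f x ≡ f y → x ≡ y) →
                      (∀ {x} → x ∈ xs → f x ∈ ys) → length xs ≤ length ys
injectiveOn⇒length≤ f {[]}     _                 _   _    = z≤n
injectiveOn⇒length≤ f {x ∷ xs} {ys} (x∉xs ∷ xs!) inj into = ≤-trans
  (s≤s (injectiveOn⇒length≤ f xs! (λ p q → inj (there p) (there q)) into′))
  (≤-reflexive (≡.sym (List.length-removeAt′ ys _)))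
  where
  into′ : ∀ {y} → y ∈ xs → f y ∈ ys ─ into (here refl)
  into′ y∈xs = ∈-─ (into (here refl)) (into (there y∈xs))
    (λ fy≡fx → All.lookup x∉xs y∈xs (≡.sym (inj (there y∈xs) (here refl) fy≡fx)))

⊆⇒length≤ : {xs ys : List A} → Unique xs → xs ⊆ ys → length xs ≤ length ys
⊆⇒length≤ xs! xs⊆ys = injectiveOn⇒length≤ (λ x → x) xs! (λ _ _ eq → eq) xs⊆ys

module _ {P : A → Set} (P? : Decidable P) where

  length-filter+length-filter-∁ : ∀ xs →
    length (filter P? xs) + length (filter (∁? P?) xs) ≡ length xs
  length-filter+length-filter-∁ []       = refl
  length-filter+length-filter-∁ (x ∷ xs) with P? x
  ... | yes _ = cong suc (length-filter+length-filter-∁ xs)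
  ... | no  _ = trans (+-suc _ _) (cong suc (length-filter+length-filter-∁ xs))

  length-filter-map : (f : B → A) (xs : List B) →
    length (filter P? (map f xs)) ≡ length (filter (P? ∘ f) xs)
  length-filter-map f []       = refl
  length-filter-map f (x ∷ xs) with P? (f x)
  ... | yes _ = cong suc (length-filter-map f xs)
  ... | no  _ = length-filter-map f xs

length-filter-cartesianProduct : ∀ {R : A → B → Set} (R? : ∀ x → Decidable (R x)) xs ys →
  length (filter (λ p → R? (proj₁ p) (proj₂ p)) (cartesianProduct xs ys)) ≡
  sum (map (λ x → length (filter (R? x) ys)) xs)
length-filter-cartesianProduct R? []       ys = refl
length-filter-cartesianProduct R? (x ∷ xs) ys = begin
  length (filter R?′ (map (x ,_) ys ++ cartesianProduct xs ys))
    ≡⟨ cong length (List.filter-++ R?′ (map (x ,_) ys) _) ⟩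
  length (filter R?′ (map (x ,_) ys) ++ filter R?′ (cartesianProduct xs ys))
    ≡⟨ List.length-++ (filter R?′ (map (x ,_) ys)) ⟩
  length (filter R?′ (map (x ,_) ys)) + length (filter R?′ (cartesianProduct xs ys))
    ≡⟨ cong₂ _+_ (length-filter-map R?′ (x ,_) ys) (length-filter-cartesianProduct R? xs ys) ⟩
  length (filter (R? x) ys) + sum (map (λ x → length (filter (R? x) ys)) xs) ∎
  where
  open ≡.≡-Reasoning
  R?′ = λ p → R? (proj₁ p) (proj₂ p)

∃∉ : ∀ {n} (xs : List (Fin n)) → length xs < n → ∃ λ z → z ∉ xs
∃∉ {n} xs |xs|<n = ¬∀⟶∃¬ n (_∈ xs) (_∈? xs) λ all∈xs →
  <⇒≱ |xs|<n (subst (_≤ length xs) (List.length-tabulate (λ i → i))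
               (⊆⇒length≤ (Unique.allFin⁺ n) (λ {z} _ → all∈xs z)))
  where open DecMembership _≟_ using (_∈?_)

IsInj₁ : A ⊎ B → Set
IsInj₁ (inj₁ _) = ⊤
IsInj₁ (inj₂ _) = ⊥

isInj₁? : Decidable (IsInj₁ {A} {B})
isInj₁? (inj₁ _) = yes tt
isInj₁? (inj₂ _) = no λ ()

transpose-ʳ : ∀ {n} (i j : Fin n) → transpose i j j ≡ i
transpose-ʳ i j with j ≟ i
... | yes j≡i = j≡i
... | no  _ with j ≟ j
...   | yes _   = refl
...   | no  j≢j = ⊥-elim (j≢j refl)

module _ {V : Set} {R : V → V → Set} {P : V → Set} where

  WalkIn-source : ∀ {x y} → WalkIn R P x y → P x
  WalkIn-source (here Px)     = Px
  WalkIn-source (step Px _ _) = Px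

  WalkIn-closed : ∀ {Q : V → Set} → (∀ {x y} → R x y → Q x → Q y) →
                  ∀ {x y} → WalkIn R P x y → Q x → Q y
  WalkIn-closed closed (here _)        Qx = Qx
  WalkIn-closed closed (step _ r walk) Qx = WalkIn-closed closed walk (closed r Qx)

  ConnectedIn-isolated : ConnectedIn R P → ∀ {x} → P x → (∀ {y} → R x y → ¬ P y) →
                         ∀ {y} → P y → y ≡ x
  ConnectedIn-isolated connected {x} Px isolated {y} Py with connected x y Px Py
  ... | here _        = refl
  ... | step _ r walk = ⊥-elim (isolated r (WalkIn-source walk))

  ConnectedIn-subsingleton : (∀ {x y} → P x → P y → x ≡ y) → ConnectedIn R P
  ConnectedIn-subsingleton unique x y Px Py rewrite unique Px Py = here Py

allFin-suc : ∀ n → allFin (suc n) ≡ fzero ∷ map fsuc (allFin n)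
allFin-suc n = cong (fzero ∷_) (≡.sym (List.map-tabulate {n = n} (λ i → i) fsuc))

length-filter-allFin-suc : ∀ k n →
  length (filter (λ j → k <? toℕ j) (allFin (suc n))) ≡
  length (filter (λ j → k <? suc (toℕ j)) (allFin n))
length-filter-allFin-suc k n =
  trans (cong (λ js → length (filter (λ j → k <? toℕ j) js)) (allFin-suc n))
        (length-filter-map (λ j → k <? toℕ j) fsuc (allFin n))

above : ∀ {n} → Fin n → ℕ
above {n} i = length (filter (λ j → toℕ i <? toℕ j) (allFin n))

above-fzero : ∀ {n} → above {suc n} fzero ≡ n
above-fzero {n} = begin
  above {suc n} fzero
    ≡⟨ length-filter-allFin-suc 0 n ⟩
  length (filter (λ j → 0 <? suc (toℕ j)) (allFin n))
    ≡⟨ cong length (List.filter-all (λ j → 0 <? suc (toℕ j))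
                                    (All.universal (λ _ → s≤s z≤n) (allFin n))) ⟩
  length (allFin n)
    ≡⟨ List.length-tabulate (λ i → i) ⟩
  n ∎
  where open ≡.≡-Reasoning

above-fsuc : ∀ {n} (i : Fin n) → above (fsuc i) ≡ above i
above-fsuc {n} i = trans (length-filter-allFin-suc (suc (toℕ i)) n)
  (cong length (List.filter-≐ (λ j → suc (toℕ i) <? suc (toℕ j)) (λ j → toℕ i <? toℕ j)
                              ((λ { (s≤s i<j) → i<j }) , s≤s) (allFin n)))

sum-above-suc : ∀ n → sum (tabulate (above {suc n})) ≡ n + sum (tabulate (above {n}))
sum-above-suc n = cong₂ _+_ (above-fzero {n}) (cong sum (List.tabulate-cong {n = n} above-fsuc))

2*sum-above : ∀ n → 2 * sum (tabulate (above {n})) ≡ n * (n ∸ 1)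
2*sum-above zero          = refl
2*sum-above (suc zero)    = refl
2*sum-above (suc (suc m)) = begin
  2 * sum (tabulate (above {suc (suc m)}))
    ≡⟨ cong (2 *_) (sum-above-suc (suc m)) ⟩
  2 * (suc m + sum (tabulate (above {suc m})))
    ≡⟨ *-distribˡ-+ 2 (suc m) _ ⟩
  2 * suc m + 2 * sum (tabulate (above {suc m}))
    ≡⟨ cong (2 * suc m +_) (2*sum-above (suc m)) ⟩
  2 * suc m + suc m * m
    ≡⟨ cong (_+ suc m * m) (*-comm 2 (suc m)) ⟩
  suc m * 2 + suc m * m
    ≡⟨ *-distribˡ-+ (suc m) 2 m ⟨
  suc m * suc (suc m)
    ≡⟨ *-comm (suc m) (suc (suc m)) ⟩
  suc (suc m) * suc m ∎
  where open ≡.≡-Reasoning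

ordered? : ∀ {n} → Decidable (λ (p : Fin n × Fin n) → toℕ (proj₁ p) < toℕ (proj₂ p))
ordered? p = toℕ (proj₁ p) <? toℕ (proj₂ p)

length-ordered-pairs : ∀ n → length (filter ordered? (allPairs n)) ≡ n * (n ∸ 1) / 2
length-ordered-pairs n = begin
  length (filter ordered? (allPairs n))
    ≡⟨ length-filter-cartesianProduct (λ i j → toℕ i <? toℕ j) (allFin n) (allFin n) ⟩
  sum (map above (allFin n))
    ≡⟨ cong sum (List.map-tabulate {n = n} (λ i → i) above) ⟩
  sum (tabulate (above {n}))
    ≡⟨ m*n/n≡m (sum (tabulate (above {n}))) 2 ⟨
  sum (tabulate (above {n})) * 2 / 2
    ≡⟨ cong (_/ 2) (trans (*-comm (sum (tabulate (above {n}))) 2) (2*sum-above n)) ⟩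
  n * (n ∸ 1) / 2 ∎
  where open ≡.≡-Reasoning

module Graph {n : ℕ} (H : SimpleGraph n) where

  Adj-sym : ∀ {i j} → Adj H i j → Adj H j i
  Adj-sym {i} {j} = subst T (sym H i j)

  Adj⇒≢ : ∀ {i j} → Adj H i j → i ≢ j
  Adj⇒≢ {i} a refl = subst T (irrefl H i) a

  Edge-≡ : {e f : Edge H} → proj₁ e ≡ proj₁ f → e ≡ f
  Edge-≡ {_ , (i<j , a)} {_ , (i<j′ , a′)} refl
    rewrite <-irrelevant i<j i<j′ | T-irrelevant a a′ = refl

  Edge-≟ : (e f : Edge H) → Dec (e ≡ f)
  Edge-≟ e f = map′ Edge-≡ (cong proj₁) (Product.≡-dec _≟_ _≟_ (proj₁ e) (proj₁ f))

  MVertex-≟ : (x y : MVertex H) → Dec (x ≡ y)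
  MVertex-≟ = Sum.≡-dec _≟_ Edge-≟

  edgeBetween : ∀ {v w} → Adj H v w → Σ (Edge H) λ e → Incident H v e × Incident H w e
  edgeBetween {v} {w} a with <-cmp (toℕ v) (toℕ w)
  ... | tri< v<w _ _ = ((v , w) , (v<w , a)) , inj₁ refl , inj₂ refl
  ... | tri≈ _ v≡w _ = ⊥-elim (Adj⇒≢ a (toℕ-injective v≡w))
  ... | tri> _ _ w<v = ((w , v) , (w<v , Adj-sym a)) , inj₂ refl , inj₁ refl

  otherEnd : ∀ {v} (e : Edge H) → Incident H v e → ∃ λ w → Adj H v w × Incident H w e
  otherEnd (_ , (_ , a)) (inj₁ refl) = _ , a , inj₂ refl
  otherEnd (_ , (_ , a)) (inj₂ refl) = _ , Adj-sym a , inj₁ refl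

  Incident⇒Adj : ∀ {v w} (e : Edge H) → Incident H v e → Incident H w e → v ≢ w → Adj H v w
  Incident⇒Adj _             (inj₁ refl) (inj₁ refl) v≢w = ⊥-elim (v≢w refl)
  Incident⇒Adj (_ , (_ , a)) (inj₁ refl) (inj₂ refl) _   = a
  Incident⇒Adj (_ , (_ , a)) (inj₂ refl) (inj₁ refl) _   = Adj-sym a
  Incident⇒Adj _             (inj₂ refl) (inj₂ refl) v≢w = ⊥-elim (v≢w refl)

  Incident-unique : ∀ {v w} {e f : Edge H} → v ≢ w →
                    Incident H v e → Incident H w e → Incident H v f → Incident H w f → e ≡ f
  Incident-unique v≢w (inj₁ refl) (inj₁ refl) _ _ = ⊥-elim (v≢w refl)
  Incident-unique v≢w (inj₂ refl) (inj₂ refl) _ _ = ⊥-elim (v≢w refl)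
  Incident-unique v≢w _ _ (inj₁ refl) (inj₁ refl) = ⊥-elim (v≢w refl)
  Incident-unique v≢w _ _ (inj₂ refl) (inj₂ refl) = ⊥-elim (v≢w refl)
  Incident-unique _ (inj₁ refl) (inj₂ refl) (inj₁ refl) (inj₂ refl) = Edge-≡ refl
  Incident-unique _ (inj₂ refl) (inj₁ refl) (inj₂ refl) (inj₁ refl) = Edge-≡ refl
  Incident-unique {e = _ , (i<j , _)} {_ , (j<i , _)} _
    (inj₁ refl) (inj₂ refl) (inj₂ refl) (inj₁ refl) = ⊥-elim (<-asym i<j j<i)
  Incident-unique {e = _ , (i<j , _)} {_ , (j<i , _)} _
    (inj₂ refl) (inj₁ refl) (inj₁ refl) (inj₂ refl) = ⊥-elim (<-asym i<j j<i)

  edges : List (Edge H)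
  edges = mapWith∈ (filter (isEdge? H) (allPairs n)) λ {p} p∈ →
    p , proj₂ (∈-filter⁻ (isEdge? H) {xs = allPairs n} p∈)

  length-edges : length edges ≡ size H
  length-edges = SetoidMembership.length-mapWith∈ (≡.setoid _) (filter (isEdge? H) (allPairs n))

  edges-unique : Unique edges
  edges-unique = Unique.map⁻ (subst Unique (≡.sym map-proj₁-edges)
    (Unique.filter⁺ (isEdge? H) (Unique.cartesianProduct⁺ (Unique.allFin⁺ n) (Unique.allFin⁺ n))))
    where
    map-proj₁-edges : map proj₁ edges ≡ filter (isEdge? H) (allPairs n)
    map-proj₁-edges = trans (SetoidMembership.map-mapWith∈ (≡.setoid _) _ _ proj₁)
                            (SetoidMembership.mapWith∈-id (≡.setoid _) _)

  ∈-edges : ∀ e → e ∈ edges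
  ∈-edges e = mapWith∈⁺ _ (proj₁ e , p∈ , Edge-≡ refl)
    where p∈ = ∈-filter⁺ (isEdge? H) (∈-cartesianProduct⁺ (∈-allFin _) (∈-allFin _)) (proj₂ e)

  neighbours : Fin n → List (Fin n)
  neighbours v = filter (λ w → T? (adj H v w)) (allFin n)

  degree≡1⇒neighbour-unique : ∀ {v a b} → degree H v ≡ 1 → Adj H v a → Adj H v b → a ≡ b
  degree≡1⇒neighbour-unique {v} {a} {b} deg≡1 va vb with a ≟ b
  ... | yes a≡b = a≡b
  ... | no  a≢b = ⊥-elim (<⇒≱ (s≤s (s≤s z≤n)) (subst (2 ≤_) deg≡1
                    (⊆⇒length≤ ((a≢b ∷ []) ∷ [] ∷ []) ab⊆neighbours)))
    where
    ab⊆neighbours : a ∷ b ∷ [] ⊆ neighbours v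
    ab⊆neighbours (here refl)         = ∈-filter⁺ (λ w → T? (adj H v w)) (∈-allFin a) va
    ab⊆neighbours (there (here refl)) = ∈-filter⁺ (λ w → T? (adj H v w)) (∈-allFin b) vb

  degree≡1⇒edge-unique : ∀ {v} {e f : Edge H} → degree H v ≡ 1 →
                         Incident H v e → Incident H v f → e ≡ f
  degree≡1⇒edge-unique {e = e} {f} deg≡1 ve vf with otherEnd e ve | otherEnd f vf
  ... | w , vw , we | w′ , vw′ , w′f
    rewrite degree≡1⇒neighbour-unique deg≡1 vw vw′ = Incident-unique (Adj⇒≢ vw′) ve we vf w′f

  ∈leaves⇒degree≡1 : ∀ {v} → v ∈ leaves H → degree H v ≡ 1
  ∈leaves⇒degree≡1 v∈leaves = proj₂ (∈-filter⁻ (λ v → degree H v ℕ.≟ 1) {xs = allFin n} v∈leaves)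

  Connected⇒neighbour : Connected H → 1 < n → ∀ v → ∃ (Adj H v)
  Connected⇒neighbour connected 1<n v with ∃∉ (v ∷ []) 1<n
  ... | z , z∉[v] with connected v z tt tt
  ...   | here _     = ⊥-elim (z∉[v] (here refl))
  ...   | step _ a _ = _ , a

  Connected⇒leaves-nonadjacent : Connected H → 2 < n → ∀ {v u} →
                                  degree H v ≡ 1 → degree H u ≡ 1 → ¬ Adj H v u
  Connected⇒leaves-nonadjacent connected 2<n {v} {u} degv degu vu with ∃∉ (v ∷ u ∷ []) 2<n
  ... | z , z∉[v,u] = z∉[v,u] (WalkIn-closed closed (connected v z tt tt) (here refl))
    where
    closed : ∀ {x y} → Adj H x y → x ∈ v ∷ u ∷ [] → y ∈ v ∷ u ∷ []
    closed xy (here refl)         = there (here (degree≡1⇒neighbour-unique degv xy vu))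
    closed xy (there (here refl)) = here (degree≡1⇒neighbour-unique degu xy (Adj-sym vu))

module LowerBound {n} (H : SimpleGraph n) (connected : Connected H) (2<n : 2 < n)
                  (D : List (MVertex H)) (D-tocds : IsTOCDS (MAdj H) D) where

  open Graph H
  open DecMembership MVertex-≟ using (_∈?_)

  L : List (Fin n)
  L = leaves H

  L-unique : Unique L
  L-unique = Unique.filter⁺ _ (Unique.allFin⁺ n)

  leaves-nonadjacent : ∀ {v w} → v ∈ L → w ∈ L → ¬ Adj H v w
  leaves-nonadjacent v∈L w∈L =
    Connected⇒leaves-nonadjacent connected 2<n (∈leaves⇒degree≡1 v∈L) (∈leaves⇒degree≡1 w∈L)

  edgeAt : ∀ v → Σ (Edge H) λ e → inj₂ e ∈ D × Incident H v e
  edgeAt v with proj₁ (proj₂ D-tocds) (inj₁ v)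
  ... | inj₁ _ , _   , ()
  ... | inj₂ e , e∈D , ve = e , e∈D , ve

  length-leaves≤edges : length L ≤ length (filter (∁? isInj₁?) D)
  length-leaves≤edges = injectiveOn⇒length≤ (inj₂ ∘ proj₁ ∘ edgeAt) L-unique injective
    (λ {v} _ → ∈-filter⁺ (∁? isInj₁?) (proj₁ (proj₂ (edgeAt v))) λ ())
    where
    injective : ∀ {v w} → v ∈ L → w ∈ L →
                inj₂ (proj₁ (edgeAt v)) ≡ inj₂ (proj₁ (edgeAt w)) → v ≡ w
    injective {v} {w} v∈L w∈L same-edge with v ≟ w
    ... | yes v≡w = v≡w
    ... | no  v≢w with edgeAt v | edgeAt w
    ...   | e , _ , ve | _ , _ , we = ⊥-elim (leaves-nonadjacent v∈L w∈L
      (Incident⇒Adj e ve (subst (Incident H w) (≡.sym (Sum.inj₂-injective same-edge)) we) v≢w))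

  module _ {v₀} (v₀∈L : v₀ ∈ L) (v₀∉D : inj₁ v₀ ∉ D) where

    others∈D : ∀ {x} → x ≢ inj₁ v₀ → x ∈ D
    others∈D {x} x≢v₀ = decidable-stable (x ∈? D) λ x∉D →
      x≢v₀ (ConnectedIn-isolated (proj₂ (proj₂ D-tocds)) v₀∉D isolated x∉D)
      where
      -- every M(H)-neighbour of the leaf v₀ is its unique edge, which lies in D
      isolated : ∀ {y} → MAdj H (inj₁ v₀) y → ¬ y ∉ D
      isolated {inj₂ e} v₀e e∉D with edgeAt v₀
      ... | e₀ , e₀∈D , v₀e₀ =
        e∉D (subst (λ f → inj₂ f ∈ D) (degree≡1⇒edge-unique (∈leaves⇒degree≡1 v₀∈L) v₀e₀ v₀e) e₀∈D)

    length-leaves≤vertices-if-leaf∉D : length L ≤ length (filter isInj₁? D)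
    length-leaves≤vertices-if-leaf∉D with otherEnd (proj₁ (edgeAt v₀)) (proj₂ (proj₂ (edgeAt v₀)))
    ... | u₀ , v₀u₀ , _ = injectiveOn⇒length≤ (inj₁ ∘ swap) L-unique
      (λ _ _ → swap-injective ∘ Sum.inj₁-injective)
      (λ v∈L → ∈-filter⁺ isInj₁? (others∈D (swap≢v₀ v∈L ∘ Sum.inj₁-injective)) tt)
      where
      swap = transpose v₀ u₀
      unswap : ∀ {v y} → swap v ≡ y → v ≡ transpose u₀ v₀ y
      unswap eq = trans (≡.sym (transpose-inverse u₀ v₀)) (cong (transpose u₀ v₀) eq)
      swap-injective : ∀ {v w} → swap v ≡ swap w → v ≡ w
      swap-injective eq = trans (unswap eq) (transpose-inverse u₀ v₀)
      swap≢v₀ : ∀ {v} → v ∈ L → swap v ≢ v₀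
      swap≢v₀ v∈L eq =
        leaves-nonadjacent v₀∈L (subst (_∈ L) (trans (unswap eq) (transpose-ʳ u₀ v₀)) v∈L) v₀u₀

  length-leaves≤vertices : length L ≤ length (filter isInj₁? D)
  length-leaves≤vertices with any? (λ v → ¬? (inj₁ v ∈? D)) L
  ... | yes leaf∉D = let (_ , v₀∈L , v₀∉D) = find leaf∉D in length-leaves≤vertices-if-leaf∉D v₀∈L v₀∉D
  ... | no ¬leaf∉D = injectiveOn⇒length≤ inj₁ L-unique (λ _ _ → Sum.inj₁-injective)
    (λ v∈L → ∈-filter⁺ isInj₁? (decidable-stable (_ ∈? D) (¬leaf∉D ∘ lose v∈L)) tt)

  2*length-leaves≤length : 2 * length L ≤ length D
  2*length-leaves≤length = begin
    2 * length L
      ≡⟨ cong (length L +_) (+-identityʳ _) ⟩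
    length L + length L
      ≤⟨ +-mono-≤ length-leaves≤vertices length-leaves≤edges ⟩
    length (filter isInj₁? D) + length (filter (∁? isInj₁?) D)
      ≡⟨ length-filter+length-filter-∁ isInj₁? D ⟩
    length D ∎
    where open ≤-Reasoning

module UpperBound {k} (H : SimpleGraph (suc k)) (neighbour : ∀ v → ∃ (Adj H v)) where

  open Graph H

  D : List (MVertex H)
  D = map (inj₁ ∘ fsuc) (allFin k) ++ map inj₂ edges

  ∈D : ∀ {x} → x ≢ inj₁ fzero → x ∈ D
  ∈D {inj₁ fzero}    x≢0 = ⊥-elim (x≢0 refl)
  ∈D {inj₁ (fsuc v)} _   = ∈-++⁺ˡ (∈-map⁺ (inj₁ ∘ fsuc) (∈-allFin v))
  ∈D {inj₂ e}        _   = ∈-++⁺ʳ _ (∈-map⁺ inj₂ (∈-edges e))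

  ∉D : ∀ {x} → x ∉ D → x ≡ inj₁ fzero
  ∉D {x} x∉D = decidable-stable (MVertex-≟ x (inj₁ fzero)) (x∉D ∘ ∈D)

  D-unique : Unique D
  D-unique = Unique.++⁺ (Unique.map⁺ (suc-injective ∘ Sum.inj₁-injective) (Unique.allFin⁺ k))
                        (Unique.map⁺ Sum.inj₂-injective edges-unique) disjoint
    where
    disjoint : Disjoint (map (inj₁ ∘ fsuc) (allFin k)) (map inj₂ edges)
    disjoint (x∈vertices , x∈edges) with ∈-map⁻ (inj₁ ∘ fsuc) x∈vertices | ∈-map⁻ inj₂ x∈edges
    ... | _ , _ , refl | _ , _ , ()

  D-tocds : IsTOCDS (MAdj H) D
  D-tocds = D-unique , dominating ,
            ConnectedIn-subsingleton (λ x∉D y∉D → trans (∉D x∉D) (≡.sym (∉D y∉D)))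
    where
    dominating : IsTotalDominating (MAdj H) D
    dominating (inj₁ v) = let (e , ve , _) = edgeBetween (proj₂ (neighbour v))
                          in inj₂ e , ∈D (λ ()) , ve
    dominating (inj₂ ((_ , fzero) , (() , _)))
    dominating (inj₂ ((_ , fsuc j) , _)) = inj₁ (fsuc j) , ∈D (λ ()) , inj₂ refl

  length-D : length D ≡ k + size H
  length-D = begin
    length D
      ≡⟨ List.length-++ (map (inj₁ ∘ fsuc) (allFin k)) ⟩
    length (map (inj₁ ∘ fsuc) (allFin k)) + length (map inj₂ edges)
      ≡⟨ cong₂ _+_ (List.length-map _ (allFin k)) (List.length-map inj₂ edges) ⟩
    length (allFin k) + length edges
      ≡⟨ cong₂ _+_ (List.length-tabulate (λ i → i)) length-edges ⟩
    k + size H ∎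
    where open ≡.≡-Reasoning

Adj-complement⇒¬Adj : ∀ {n} (G : SimpleGraph n) {i j} → Adj (complement G) i j → ¬ Adj G i j
Adj-complement⇒¬Adj G {i} {j} ij∈Gᶜ ij∈G with i ≟ j
... | yes _ = ij∈Gᶜ
... | no  _ with adj G i j
...   | true  = ij∈Gᶜ
...   | false = ij∈G

size-complement+size≤ : ∀ {n} (G : SimpleGraph n) → size (complement G) + size G ≤ n * (n ∸ 1) / 2
size-complement+size≤ {n} G = begin
  size (complement G) + size G
    ≡⟨ List.length-++ (edgePairs (complement G)) ⟨
  length (edgePairs (complement G) ++ edgePairs G)
    ≤⟨ ⊆⇒length≤ (Unique.++⁺ (edgePairs-unique (complement G)) (edgePairs-unique G) disjoint)
                  ([ edgePairs⊆ordered (complement G) , edgePairs⊆ordered G ]′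
                     ∘ ∈-++⁻ (edgePairs (complement G))) ⟩
  length (filter ordered? (allPairs n))
    ≡⟨ length-ordered-pairs n ⟩
  n * (n ∸ 1) / 2 ∎
  where
  open ≤-Reasoning
  edgePairs : SimpleGraph n → List (Fin n × Fin n)
  edgePairs H = filter (isEdge? H) (allPairs n)
  edgePairs-unique : ∀ H → Unique (edgePairs H)
  edgePairs-unique H = Unique.filter⁺ (isEdge? H)
    (Unique.cartesianProduct⁺ (Unique.allFin⁺ n) (Unique.allFin⁺ n))
  edgePairs⊆ordered : ∀ H → edgePairs H ⊆ filter ordered? (allPairs n)
  edgePairs⊆ordered H p∈ = let (p∈pairs , ordered , _) = ∈-filter⁻ (isEdge? H) {xs = allPairs n} p∈
                           in ∈-filter⁺ ordered? p∈pairs ordered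
  disjoint : Disjoint (edgePairs (complement G)) (edgePairs G)
  disjoint (p∈Gᶜ , p∈G) = Adj-complement⇒¬Adj G
    (proj₂ (proj₂ (∈-filter⁻ (isEdge? (complement G)) {xs = allPairs n} p∈Gᶜ)))
    (proj₂ (proj₂ (∈-filter⁻ (isEdge? G) {xs = allPairs n} p∈G)))

m+a≤1+m+t∸b∸1 : ∀ m {a b t} → a + b ≤ t → m + a ≤ suc m + t ∸ b ∸ 1
m+a≤1+m+t∸b∸1 m {a} {b} {t} a+b≤t =
  m+n≤o⇒m≤o∸n (m + a) (m+n≤o⇒m≤o∸n (m + a + 1) (begin
    m + a + 1 + b   ≡⟨ rearrange m a b ⟩
    suc m + (a + b) ≤⟨ +-monoʳ-≤ (suc m) a+b≤t ⟩
    suc m + t       ∎))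
  where
  open ≤-Reasoning
  rearrange : ∀ m a b → m + a + 1 + b ≡ suc m + (a + b)
  rearrange = solve-∀

proposition5p1 : ∀ (n : ℕ) (G : SimpleGraph n) → 4 ≤ n → Connected G → Connected (complement G) →
    (∀ (D : List (MVertex (complement G))) → IsTOCDS (MAdj (complement G)) D →
      2 * length (leaves (complement G)) ≤ length D)
    × (∃ λ (D : List (MVertex (complement G))) → IsTOCDS (MAdj (complement G)) D
      × length D ≤ n + n * (n ∸ 1) / 2 ∸ size G ∸ 1)
proposition5p1 n@(suc k) G (s≤s (s≤s (s≤s (s≤s _)))) _ Gᶜ-connected =
  LowerBound.2*length-leaves≤length Gᶜ Gᶜ-connected (s≤s (s≤s (s≤s z≤n))) ,
  (UpperBound.D Gᶜ neighbour , UpperBound.D-tocds Gᶜ neighbour ,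
   subst (_≤ n + n * (n ∸ 1) / 2 ∸ size G ∸ 1) (≡.sym (UpperBound.length-D Gᶜ neighbour))
     (m+a≤1+m+t∸b∸1 k (size-complement+size≤ G)))
  where
  Gᶜ = complement G
  neighbour : ∀ v → ∃ (Adj Gᶜ v)
  neighbour = Graph.Connected⇒neighbour Gᶜ Gᶜ-connected (s≤s (s≤s z≤n))
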